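{- Let $R$ be a finite commutative local principal ideal ring with unity. Then the complement $\overline{\Gamma(R)}$ of the zero divisor graph of $R$ is a divisor graph.
   Context: For a commutative ring $R$ with unity, $Z(R)$ denotes its set of zero divisors. The zero divisor graph $\Gamma(R)$ has vertex set $Z(R)\setminus\{0\}$, with distinct vertices $a,b$ adjacent iff $ab=0$. Its complement $\overline{\Gamma(R)}$ has the same vertex set, with distinct vertices $a,b$ adjacent iff $ab\neq 0$. For a nonempty set $S$ of positive integers, the divisor graph $G(S)$ has vertex set $S$, with distinct $i,j$ adjacent iff $i\mid j$ or $j\mid i$. A graph $G$ is a divisor graph if $G\cong G(S)$ for some set $S$ of positive integers. A local ring is one with a unique maximal ideal. -}

module Defs where

open import Level using (Level; _⊔_)
open import Algebra.Bundles using (CommutativeRing)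
open import Data.Nat using (ℕ; _≤_)
open import Data.Nat.Divisibility using (_∣_)
open import Data.Fin using (Fin)
open import Data.Product using (Σ; ∃; _×_; _,_)
open import Data.Sum using (_⊎_)
open import Relation.Nullary using (¬_)
open import Relation.Binary.PropositionalEquality using (_≡_)
open import Function.Bundles using (_⇔_)

module _ {c ℓ : Level} (R : CommutativeRing c ℓ) where
  open CommutativeRing R

  IsFinite : Set (c ⊔ ℓ)
  IsFinite = Σ ℕ λ n → Σ (Fin n → Carrier) λ f → ∀ x → ∃ λ i → f i ≈ x

  record Ideal : Set (Level.suc (c ⊔ ℓ)) where
    field
      mem      : Carrier → Set (c ⊔ ℓ)
      resp     : ∀ {x y} → x ≈ y → mem x → mem y
      has0     : mem 0#
      +-closed : ∀ {x y} → mem x → mem y → mem (x + y)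
      *-closed : ∀ r {x} → mem x → mem (r * x)
  open Ideal public

  _⊆ᵢ_ : Ideal → Ideal → Set (c ⊔ ℓ)
  I ⊆ᵢ J = ∀ {x} → mem I x → mem J x

  _≐ᵢ_ : Ideal → Ideal → Set (c ⊔ ℓ)
  I ≐ᵢ J = (I ⊆ᵢ J) × (J ⊆ᵢ I)

  Proper : Ideal → Set (c ⊔ ℓ)
  Proper I = ¬ mem I 1#

  IsMaximal : Ideal → Set (Level.suc (c ⊔ ℓ))
  IsMaximal M = Proper M × (∀ J → M ⊆ᵢ J → (J ≐ᵢ M) ⊎ mem J 1#)

  IsLocal : Set (Level.suc (c ⊔ ℓ))
  IsLocal = Σ Ideal λ M → IsMaximal M × (∀ N → IsMaximal N → N ≐ᵢ M)

  IsPrincipal : Ideal → Set (c ⊔ ℓ)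
  IsPrincipal I = ∃ λ a → ∀ x → mem I x ⇔ (∃ λ r → x ≈ r * a)

  IsPrincipalIdealRing : Set (Level.suc (c ⊔ ℓ))
  IsPrincipalIdealRing = ∀ I → IsPrincipal I

  IsZeroDivisor : Carrier → Set (c ⊔ ℓ)
  IsZeroDivisor a = ∃ λ b → ¬ (b ≈ 0#) × (a * b ≈ 0#)

  Vertex : Carrier → Set (c ⊔ ℓ)
  Vertex a = IsZeroDivisor a × ¬ (a ≈ 0#)

  -- Adjacency in the complement of Γ(R) (for distinct vertices): ab ≠ 0.
  ComplAdj : Carrier → Carrier → Set ℓ
  ComplAdj a b = ¬ (a * b ≈ 0#)

  -- The graph with vertex set V ⊆ R (up to ≈) and adjacency E on distinct
  -- vertices is isomorphic to the divisor graph G(S), where S = φ(V) is a set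
  -- of positive integers and φ : V → S is the isomorphism (a bijection onto
  -- its image S, preserving and reflecting adjacency).
  IsDivisorGraph : (V : Carrier → Set (c ⊔ ℓ)) (E : Carrier → Carrier → Set ℓ)
                 → Set (c ⊔ ℓ)
  IsDivisorGraph V E =
    Σ (Carrier → ℕ) λ φ →
      (∀ {a} → V a → 1 ≤ φ a)
    × (∀ {a b} → V a → V b → (a ≈ b ⇔ φ a ≡ φ b))
    × (∀ {a b} → V a → V b → ¬ (a ≈ b) →
         (E a b ⇔ ((φ a ∣ φ b) ⊎ (φ b ∣ φ a))))

  ComplementZeroDivisorGraphIsDivisorGraph : Set (c ⊔ ℓ)
  ComplementZeroDivisorGraphIsDivisorGraph = IsDivisorGraph Vertex ComplAdj

module Submission where

-- A finite local principal ideal ring is a chain ring: if (a, b) = (g) with a = r g and b = s g, then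
-- r or s is a unit, or else g ∈ M g and so g = 0.  Hence Ann a and (b) are comparable ideals, and
-- a b ≠ 0 iff b ∉ Ann a iff |Ann a| < |(b)|.  Also two elements with nonzero squares have nonzero
-- product, and two with zero squares have zero product.  So the complement of Γ(R) is a split graph
-- (clique: a² ≠ 0, independent set: a² = 0) whose cross edges are given by a numerical threshold,
-- and such a graph is a divisor graph.  The ring is classical for free: its maximal ideal decides
-- every proposition, which makes the cardinalities of ideals available.

open import Algebra.Bundles using (CommutativeRing)
open import Data.Bool.Properties using (T-≡)
open import Data.Fin using (Fin; zero; suc; toℕ)
open import Data.Fin.Properties using (toℕ-injective; toℕ<n)
open import Data.Fin.Subset using (Subset; _∈_; ∣_∣) renaming (_⊆_ to _⊆ˢ_)
open import Data.Fin.Subset.Properties using (p⊆q⇒∣p∣≤∣q∣; p⊂q⇒∣p∣<∣q∣; ∣p∣≤n)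
open import Data.Nat using (ℕ; zero; suc; _≤_; _<_)
open import Data.Nat.Properties using (≤-antisym; <⇒≱)
open import Data.Product using (Σ; ∃; ∃₂; _×_; _,_; proj₁; proj₂)
open import Data.Sum using (_⊎_; inj₁; inj₂)
open import Data.Vec using (tabulate)
open import Data.Vec.Properties using (lookup∘tabulate; []=⇒lookup; lookup⇒[]=)
open import Function using (_∘_; id)
open import Function.Bundles using (_⇔_; mk⇔; Equivalence)
open import Level using (Level; _⊔_; Lift; lift; lower)
open import Relation.Binary.PropositionalEquality as ≡ using (_≡_; cong)
open import Relation.Nullary using (¬_; Dec; yes; no; does; contradiction)
open import Relation.Nullary.Decidable using (dec-true; isYes≗does; toWitness; map′)
open import Relation.Unary using (Pred; Decidable)
open import Defs

open Equivalence using (to; from)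

module DivisorLabelling where

  open import Data.Nat using (_+_; _*_; _∸_; _^_; z≤n; s≤s; _<?_)
  open import Data.Nat.Properties as ℕₚ
    using ( ≤-trans; ≤-total; <⇒≤; ≮⇒≥; <-≤-trans; m≤m+n; m≤n+m; m<n⇒m<1+n; m<n⇒n≢0
          ; m≤n⇒m<n∨m≡n; m<n⇒0<n∸m; ∸-monoʳ-<; +-mono-≤; +-monoʳ-≤; +-monoˡ-<; +-cancelˡ-≡
          ; *-mono-≤; *-monoˡ-≤; m^n>0; module ≤-Reasoning)
  open import Data.Nat.Divisibility
    using (_∣_; _∣?_; ∣-trans; ∣-reflexive; 1∣_; ∣1⇒≡1; m∣m*n; n∣m*n; *-pres-∣; *-monoʳ-∣; *-cancelˡ-∣)
  open import Data.Nat.DivMod using (_%_; [m+kn]%n≡m%n; m<n⇒m%n≡m)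
  open import Data.Nat.Primality using (Prime; prime?; prime[2]; ¬prime[1]; euclidsLemma; prime⇒nonZero)
  open import Relation.Binary.PropositionalEquality using (cong₂; subst; module ≡-Reasoning)
  open import Relation.Nullary.Decidable using (from-yes; from-no)

  pow-mono-∣ : ∀ p {m n} → m ≤ n → p ^ m ∣ p ^ n
  pow-mono-∣ p {n = n} z≤n       = 1∣ (p ^ n)
  pow-mono-∣ p         (s≤s m≤n) = *-monoʳ-∣ p (pow-mono-∣ p m≤n)

  prime∤pow : ∀ {p q} → Prime p → ¬ p ∣ q → ∀ k → ¬ p ∣ q ^ k
  prime∤pow pp p∤q zero    p∣1 = ¬prime[1] (subst Prime (∣1⇒≡1 p∣1) pp)
  prime∤pow {q = q} pp p∤q (suc k) p∣qqᵏ with euclidsLemma q (q ^ k) pp p∣qqᵏ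
  ... | inj₁ p∣q  = p∤q p∣q
  ... | inj₂ p∣qᵏ = prime∤pow pp p∤q k p∣qᵏ

  prime-pow-∣⇒≤ : ∀ {p q} → Prime p → ¬ p ∣ q → ∀ m n k → p ^ m ∣ p ^ n * q ^ k → m ≤ n
  prime-pow-∣⇒≤ pp p∤q zero    n       k _ = z≤n
  prime-pow-∣⇒≤ {p} {q} pp p∤q (suc m) zero k d =
    contradiction (∣-trans (m∣m*n (p ^ m)) (subst (p * p ^ m ∣_) (ℕₚ.+-identityʳ (q ^ k)) d)) (prime∤pow pp p∤q k)
  prime-pow-∣⇒≤ {p} {q} pp p∤q (suc m) (suc n) k d =
    s≤s (prime-pow-∣⇒≤ pp p∤q m n k
          (*-cancelˡ-∣ p {{prime⇒nonZero pp}} (subst (p * p ^ m ∣_) (ℕₚ.*-assoc p (p ^ n) (q ^ k)) d)))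

  -- Opaque, so that unification can read the exponents off a label.
  opaque
    smooth : ℕ → ℕ → ℕ
    smooth m n = 2 ^ m * 3 ^ n

    smooth-positive : ∀ m n → 1 ≤ smooth m n
    smooth-positive m n = *-mono-≤ (m^n>0 2 m) (m^n>0 3 n)

    smooth-∣⇔ : ∀ {m n m′ n′} → smooth m n ∣ smooth m′ n′ ⇔ (m ≤ m′ × n ≤ n′)
    smooth-∣⇔ {m} {n} {m′} {n′} =
      mk⇔ exponents-≤ λ (m≤m′ , n≤n′) → *-pres-∣ (pow-mono-∣ 2 m≤m′) (pow-mono-∣ 3 n≤n′)
      where
      exponents-≤ : smooth m n ∣ smooth m′ n′ → m ≤ m′ × n ≤ n′
      exponents-≤ d =
          prime-pow-∣⇒≤ prime[2] (from-no (2 ∣? 3)) m m′ n′ (∣-trans (m∣m*n (3 ^ n)) d)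
        , prime-pow-∣⇒≤ (from-yes (prime? 3)) (from-no (3 ∣? 2)) n n′ m′
            (subst (3 ^ n ∣_) (ℕₚ.*-comm (2 ^ m′) (3 ^ n′)) (∣-trans (n∣m*n (2 ^ m)) d))

  smooth-injective : ∀ {m n m′ n′} → smooth m n ≡ smooth m′ n′ → m ≡ m′ × n ≡ n′
  smooth-injective e with to smooth-∣⇔ (∣-reflexive e) | to smooth-∣⇔ (∣-reflexive (≡.sym e))
  ... | m≤m′ , n≤n′ | m′≤m , n′≤n = ≤-antisym m≤m′ m′≤m , ≤-antisym n≤n′ n′≤n

  Comparable : ℕ → ℕ → Set
  Comparable m n = (m ∣ n) ⊎ (n ∣ m)

  comparable-sym : ∀ {m n} → Comparable m n → Comparable n m
  comparable-sym (inj₁ m∣n) = inj₂ m∣n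
  comparable-sym (inj₂ n∣m) = inj₁ n∣m

  -- Clique vertices get labels 2 ^ T and independent ones 2 ^ K * 3 ^ (B ∸ K), where T and K write
  -- (t, ι) and (k, ι) in base W so that T x ≤ K y iff t x < k y; the constant exponent sum B makes
  -- the labels of the second kind an antichain.
  module SplitThresholdGraph
    {a ℓ p e} {A : Set a} (_≈_ : A → A → Set ℓ) (≈-sym : ∀ {x y} → x ≈ y → y ≈ x)
    (E : A → A → Set e) (E-sym : ∀ {x y} → E x y → E y x)
    (N : ℕ) (ι : A → ℕ) (ι<N : ∀ x → ι x < N)
    (ι-cong : ∀ {x y} → x ≈ y → ι x ≡ ι y) (ι-injective : ∀ {x y} → ι x ≡ ι y → x ≈ y)
    {Indep : A → Set p} (indep? : ∀ x → Dec (Indep x)) (Indep-resp : ∀ {x y} → x ≈ y → Indep x → Indep y)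
    (t k : A → ℕ) (t-cong : ∀ {x y} → x ≈ y → t x ≡ t y) (k-cong : ∀ {x y} → x ≈ y → k x ≡ k y)
    (k≤N : ∀ x → k x ≤ N)
    (clique : ∀ {x y} → ¬ Indep x → ¬ Indep y → E x y)
    (independent : ∀ {x y} → Indep x → Indep y → ¬ E x y)
    (threshold : ∀ {x y} → ¬ Indep x → Indep y → E x y ⇔ t x < k y)
    where

    W B : ℕ
    W = suc (N + N)
    B = suc N * W

    T K : A → ℕ
    T x = ι x + suc (t x) * W
    K x = (N + ι x) + k x * W

    φ : A → ℕ
    φ x with indep? x
    ... | no _  = smooth (T x) 0
    ... | yes _ = smooth (K x) (B ∸ K x)

    private
      digit<suc : ∀ {r} q → r < W → r + q * W < suc q * W
      digit<suc q r<W = +-monoˡ-< (q * W) r<W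

      digit-% : ∀ {r} q → r < W → (r + q * W) % W ≡ r
      digit-% {r} q r<W = ≡.trans ([m+kn]%n≡m%n r q W) (m<n⇒m%n≡m r<W)

      ι<W : ∀ x → ι x < W
      ι<W x = m<n⇒m<1+n (≤-trans (ι<N x) (m≤m+n N N))

      N+ι<W : ∀ x → N + ι x < W
      N+ι<W x = s≤s (+-monoʳ-≤ N (<⇒≤ (ι<N x)))

    T-cong : ∀ {x y} → x ≈ y → T x ≡ T y
    T-cong x≈y = cong₂ (λ i s → i + suc s * W) (ι-cong x≈y) (t-cong x≈y)

    K-cong : ∀ {x y} → x ≈ y → K x ≡ K y
    K-cong x≈y = cong₂ (λ i s → (N + i) + s * W) (ι-cong x≈y) (k-cong x≈y)

    T-injective : ∀ {x y} → T x ≡ T y → x ≈ y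
    T-injective {x} {y} e = ι-injective (begin
      ι x      ≡⟨ digit-% (suc (t x)) (ι<W x) ⟨
      T x % W  ≡⟨ cong (_% W) e ⟩
      T y % W  ≡⟨ digit-% (suc (t y)) (ι<W y) ⟩
      ι y      ∎)
      where open ≡-Reasoning

    K-injective : ∀ {x y} → K x ≡ K y → x ≈ y
    K-injective {x} {y} e = ι-injective (+-cancelˡ-≡ N _ _ (begin
      N + ι x  ≡⟨ digit-% (k x) (N+ι<W x) ⟨
      K x % W  ≡⟨ cong (_% W) e ⟩
      K y % W  ≡⟨ digit-% (k y) (N+ι<W y) ⟩
      N + ι y  ∎))
      where open ≡-Reasoning

    K<B : ∀ x → K x < B
    K<B x = <-≤-trans (digit<suc (k x) (N+ι<W x)) (*-monoˡ-≤ W (s≤s (k≤N x)))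

    T≤K⇔t<k : ∀ {x y} → T x ≤ K y ⇔ t x < k y
    T≤K⇔t<k {x} {y} = mk⇔ T≤K⇒t<k t<k⇒T≤K
      where
      t<k⇒T≤K : t x < k y → T x ≤ K y
      t<k⇒T≤K t<k = +-mono-≤ (≤-trans (<⇒≤ (ι<N x)) (m≤m+n N (ι y))) (*-monoˡ-≤ W t<k)

      T≤K⇒t<k : T x ≤ K y → t x < k y
      T≤K⇒t<k T≤K with t x <? k y
      ... | yes t<k = t<k
      ... | no t≮k  = contradiction T≤K (<⇒≱ (begin-strict
        K y            <⟨ digit<suc (k y) (N+ι<W y) ⟩
        suc (k y) * W  ≤⟨ *-monoˡ-≤ W (s≤s (≮⇒≥ t≮k)) ⟩
        suc (t x) * W  ≤⟨ m≤n+m (suc (t x) * W) (ι x) ⟩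
        T x            ∎))
        where open ≤-Reasoning

    private
      K-label∤T-label : ∀ y m → ¬ smooth (K y) (B ∸ K y) ∣ smooth m 0
      K-label∤T-label y m d = <⇒≱ (m<n⇒0<n∸m (K<B y)) (proj₂ (to smooth-∣⇔ d))

      K-labels-antichain : ∀ {x y} → smooth (K x) (B ∸ K x) ∣ smooth (K y) (B ∸ K y) → x ≈ y
      K-labels-antichain {x} {y} d with to smooth-∣⇔ d
      ... | Kx≤Ky , B∸Kx≤B∸Ky with m≤n⇒m<n∨m≡n Kx≤Ky
      ...   | inj₁ Kx<Ky = contradiction B∸Kx≤B∸Ky (<⇒≱ (∸-monoʳ-< Kx<Ky (<⇒≤ (K<B y))))
      ...   | inj₂ Kx≡Ky = K-injective Kx≡Ky

      T-labels-chain : ∀ m n → Comparable (smooth m 0) (smooth n 0)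
      T-labels-chain m n with ≤-total m n
      ... | inj₁ m≤n = inj₁ (from smooth-∣⇔ (m≤n , z≤n))
      ... | inj₂ n≤m = inj₂ (from smooth-∣⇔ (n≤m , z≤n))

      threshold-comparable : ∀ {x y} → ¬ Indep x → Indep y →
                             E x y ⇔ Comparable (smooth (T x) 0) (smooth (K y) (B ∸ K y))
      threshold-comparable {x} {y} ¬ix iy = mk⇔
        (λ Exy → inj₁ (from smooth-∣⇔ (from T≤K⇔t<k (to (threshold ¬ix iy) Exy) , z≤n)))
        λ { (inj₁ d) → from (threshold ¬ix iy) (to T≤K⇔t<k (proj₁ (to smooth-∣⇔ d)))
          ; (inj₂ d) → contradiction d (K-label∤T-label y (T x)) }

    φ-positive : ∀ x → 1 ≤ φ x
    φ-positive x with indep? x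
    ... | no _  = smooth-positive (T x) 0
    ... | yes _ = smooth-positive (K x) (B ∸ K x)

    ≈⇔φ≡ : ∀ {x y} → x ≈ y ⇔ φ x ≡ φ y
    ≈⇔φ≡ {x} {y} = mk⇔ ≈⇒φ≡ φ≡⇒≈
      where
      ≈⇒φ≡ : x ≈ y → φ x ≡ φ y
      ≈⇒φ≡ x≈y with indep? x | indep? y
      ... | no _   | no _   = cong (λ m → smooth m 0) (T-cong x≈y)
      ... | yes _  | yes _  = cong (λ m → smooth m (B ∸ m)) (K-cong x≈y)
      ... | yes ix | no ¬iy = contradiction (Indep-resp x≈y ix) ¬iy
      ... | no ¬ix | yes iy = contradiction (Indep-resp (≈-sym x≈y) iy) ¬ix

      φ≡⇒≈ : φ x ≡ φ y → x ≈ y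
      φ≡⇒≈ e with indep? x | indep? y
      ... | no _  | no _  = T-injective (proj₁ (smooth-injective e))
      ... | yes _ | yes _ = K-injective (proj₁ (smooth-injective e))
      ... | no _  | yes _ = contradiction (≡.sym (proj₂ (smooth-injective e))) (m<n⇒n≢0 (m<n⇒0<n∸m (K<B y)))
      ... | yes _ | no _  = contradiction (proj₂ (smooth-injective e)) (m<n⇒n≢0 (m<n⇒0<n∸m (K<B x)))

    E⇔comparable : ∀ {x y} → ¬ x ≈ y → E x y ⇔ Comparable (φ x) (φ y)
    E⇔comparable {x} {y} x≉y with indep? x | indep? y
    ... | no ¬ix | no ¬iy = mk⇔ (λ _ → T-labels-chain (T x) (T y)) (λ _ → clique ¬ix ¬iy)
    ... | yes ix | yes iy = mk⇔ (λ Exy → contradiction Exy (independent ix iy))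
                                λ { (inj₁ d) → contradiction (K-labels-antichain d) x≉y
                                  ; (inj₂ d) → contradiction (≈-sym (K-labels-antichain d)) x≉y }
    ... | no ¬ix | yes iy = threshold-comparable ¬ix iy
    ... | yes ix | no ¬iy = mk⇔ (λ Exy → comparable-sym (to (threshold-comparable ¬iy ix) (E-sym Exy)))
                                (λ c → E-sym (from (threshold-comparable ¬iy ix) (comparable-sym c)))

open DivisorLabelling using (module SplitThresholdGraph)

module _ {n p} {P : Pred (Fin n) p} where

  subsetOf : Decidable P → Subset n
  subsetOf P? = tabulate (does ∘ P?)

  ∈-subsetOf : (P? : Decidable P) {i : Fin n} → i ∈ subsetOf P? ⇔ P i
  ∈-subsetOf P? {i} = mk⇔
    (λ i∈ → toWitness (from T-≡ (≡.trans (isYes≗does (P? i))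
                                  (≡.trans (≡.sym (lookup∘tabulate (does ∘ P?) i)) ([]=⇒lookup i∈)))))
    (λ Pi → lookup⇒[]= i _ (≡.trans (lookup∘tabulate (does ∘ P?) i) (dec-true (P? i) Pi)))

firstIndex : ∀ {n p} {P : Pred (Fin n) p} → Decidable P → ℕ
firstIndex {zero}  P? = zero
firstIndex {suc n} P? with P? zero
... | yes _ = zero
... | no _  = suc (firstIndex (P? ∘ suc))

firstIndex-spec : ∀ {n p} {P : Pred (Fin n) p} (P? : Decidable P) {i} → P i →
                  ∃ λ j → toℕ j ≡ firstIndex P? × P j
firstIndex-spec {suc n} P? {i} Pi with P? zero | i
... | yes P0 | _     = zero , ≡.refl , P0
... | no ¬P0 | zero  = contradiction Pi ¬P0
... | no _   | suc i with firstIndex-spec (P? ∘ suc) Pi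
...   | j , j≡ , Pj = suc j , cong suc j≡ , Pj

firstIndex-cong : ∀ {n p q} {P : Pred (Fin n) p} {Q : Pred (Fin n) q} (P? : Decidable P) (Q? : Decidable Q) →
                  (∀ i → P i → Q i) → (∀ i → Q i → P i) → firstIndex P? ≡ firstIndex Q?
firstIndex-cong {zero}  P? Q? P⇒Q Q⇒P = ≡.refl
firstIndex-cong {suc n} P? Q? P⇒Q Q⇒P with P? zero | Q? zero
... | yes _  | yes _  = ≡.refl
... | yes P0 | no ¬Q0 = contradiction (P⇒Q zero P0) ¬Q0
... | no ¬P0 | yes Q0 = contradiction (Q⇒P zero Q0) ¬P0
... | no _   | no _   = cong suc (firstIndex-cong (P? ∘ suc) (Q? ∘ suc) (P⇒Q ∘ suc) (Q⇒P ∘ suc))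

module Ideals {c ℓ} (R : CommutativeRing c ℓ) where

  open CommutativeRing R hiding (zero)
  open import Algebra.Properties.CommutativeSemigroup +-commutativeSemigroup using () renaming (interchange to +-interchange)
  open import Algebra.Properties.CommutativeSemigroup *-commutativeSemigroup using (x∙yz≈y∙xz; xy∙z≈y∙xz)
  open import Relation.Binary.Reasoning.Setoid setoid

  infix 4 _∈ᵢ_ _⊆_
  infixl 6 _⊕_

  _∈ᵢ_ : Carrier → Ideal R → Set (c ⊔ ℓ)
  x ∈ᵢ I = mem I x

  _⊆_ : Ideal R → Ideal R → Set (c ⊔ ℓ)
  _⊆_ = _⊆ᵢ_ R

  ⟨_⟩ : Carrier → Ideal R
  ⟨ a ⟩ = record
    { mem      = λ x → ∃ λ r → x ≈ r * a
    ; resp     = λ { x≈y (r , x≈ra) → r , trans (sym x≈y) x≈ra }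
    ; has0     = 0# , sym (zeroˡ a)
    ; +-closed = λ { (r , x≈ra) (s , y≈sa) → r + s , trans (+-cong x≈ra y≈sa) (sym (distribʳ a r s)) }
    ; *-closed = λ { r (s , x≈sa) → r * s , trans (*-cong refl x≈sa) (sym (*-assoc r s a)) }
    }

  _⊕_ : Ideal R → Ideal R → Ideal R
  I ⊕ J = record
    { mem      = λ x → ∃₂ λ i j → i ∈ᵢ I × j ∈ᵢ J × x ≈ i + j
    ; resp     = λ { x≈y (i , j , i∈I , j∈J , x≈i+j) → i , j , i∈I , j∈J , trans (sym x≈y) x≈i+j }
    ; has0     = 0# , 0# , has0 I , has0 J , sym (+-identityʳ 0#)
    ; +-closed = λ { (i , j , i∈I , j∈J , x≈i+j) (i′ , j′ , i′∈I , j′∈J , y≈i′+j′) →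
                     i + i′ , j + j′ , +-closed I i∈I i′∈I , +-closed J j∈J j′∈J
                   , trans (+-cong x≈i+j y≈i′+j′) (+-interchange i j i′ j′) }
    ; *-closed = λ { r (i , j , i∈I , j∈J , x≈i+j) →
                     r * i , r * j , *-closed I r i∈I , *-closed J r j∈J
                   , trans (*-cong refl x≈i+j) (distribˡ r i j) }
    }

  Ann : Carrier → Ideal R
  Ann a = record
    { mem      = λ x → Lift c (a * x ≈ 0#)
    ; resp     = λ { x≈y (lift ax≈0) → lift (trans (*-cong refl (sym x≈y)) ax≈0) }
    ; has0     = lift (zeroʳ a)
    ; +-closed = λ { (lift ax≈0) (lift ay≈0) →
                     lift (trans (distribˡ a _ _) (trans (+-cong ax≈0 ay≈0) (+-identityʳ 0#))) }
    ; *-closed = λ { r {x} (lift ax≈0) → lift (trans (x∙yz≈y∙xz a r x) (trans (*-cong refl ax≈0) (zeroʳ r))) }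
    }

  Unit : Carrier → Set (c ⊔ ℓ)
  Unit x = ∃ λ y → x * y ≈ 1#

  x∈⟨x⟩ : ∀ x → x ∈ᵢ ⟨ x ⟩
  x∈⟨x⟩ x = 1# , sym (*-identityˡ x)

  ⟨⟩-least : ∀ {I x} → x ∈ᵢ I → ⟨ x ⟩ ⊆ I
  ⟨⟩-least {I} x∈I (r , y≈rx) = resp I (sym y≈rx) (*-closed I r x∈I)

  ⊕-inˡ : ∀ {I J} → I ⊆ I ⊕ J
  ⊕-inˡ {J = J} {i} i∈I = i , 0# , i∈I , has0 J , sym (+-identityʳ i)

  ⊕-inʳ : ∀ {I J} → J ⊆ I ⊕ J
  ⊕-inʳ {I} {x = j} j∈J = 0# , j , has0 I , j∈J , sym (+-identityˡ j)

  ⊕-least : ∀ {I J K} → I ⊆ K → J ⊆ K → I ⊕ J ⊆ K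
  ⊕-least {K = K} I⊆K J⊆K (i , j , i∈I , j∈J , x≈i+j) = resp K (sym x≈i+j) (+-closed K (I⊆K i∈I) (J⊆K j∈J))

  ⊕-monoˡ : ∀ {I J K} → I ⊆ J → I ⊕ K ⊆ J ⊕ K
  ⊕-monoˡ {I} {J} {K} I⊆J = ⊕-least {I} {K} {J ⊕ K} (λ i∈I → ⊕-inˡ {J} {K} (I⊆J i∈I)) (⊕-inʳ {J} {K})

  1∈⟨x⟩⇒unit : ∀ {x} → 1# ∈ᵢ ⟨ x ⟩ → Unit x
  1∈⟨x⟩⇒unit {x} (r , 1≈rx) = r , trans (*-comm x r) (sym 1≈rx)

  unit-factor : ∀ {a r g} → Unit r → a ≈ r * g → g ∈ᵢ ⟨ a ⟩
  unit-factor {a} {r} {g} (w , rw≈1) a≈rg = w , (begin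
    g             ≈⟨ *-identityˡ g ⟨
    1# * g        ≈⟨ *-cong rw≈1 refl ⟨
    (r * w) * g   ≈⟨ xy∙z≈y∙xz r w g ⟩
    w * (r * g)   ≈⟨ *-cong refl a≈rg ⟨
    w * a         ∎)

  -- M ∪ {everything, if P} is an ideal; maximality says whether it is M or the whole ring.
  maximal⇒dec : ∀ {M} → IsMaximal R M → (P : Set (c ⊔ ℓ)) → Dec P
  maximal⇒dec {M} (M-proper , M-maximal) P with M-maximal M∪P inj₁
    where
    M∪P : Ideal R
    M∪P = record
      { mem      = λ x → x ∈ᵢ M ⊎ P
      ; resp     = λ { x≈y (inj₁ x∈M) → inj₁ (resp M x≈y x∈M) ; _ (inj₂ p) → inj₂ p }
      ; has0     = inj₁ (has0 M)
      ; +-closed = λ { (inj₁ x∈M) (inj₁ y∈M) → inj₁ (+-closed M x∈M y∈M)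
                     ; (inj₂ p) _ → inj₂ p ; _ (inj₂ p) → inj₂ p }
      ; *-closed = λ { r (inj₁ x∈M) → inj₁ (*-closed M r x∈M) ; r (inj₂ p) → inj₂ p }
      }
  ... | inj₁ (M∪P⊆M , _) = no λ p → M-proper (M∪P⊆M (inj₂ p))
  ... | inj₂ (inj₁ 1∈M)  = contradiction 1∈M M-proper
  ... | inj₂ (inj₂ p)    = yes p

module Saturation {c ℓ} (R : CommutativeRing c ℓ) (dec : (P : Set (c ⊔ ℓ)) → Dec P) where

  open CommutativeRing R hiding (zero)
  open Ideals R

  Saturated : ∀ {n} → (Fin n → Carrier) → Ideal R → Set (c ⊔ ℓ)
  Saturated g J = ∀ i → g i ∈ᵢ J ⊎ 1# ∈ᵢ J ⊕ ⟨ g i ⟩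

  saturate : ∀ {n} (g : Fin n → Carrier) {I} → Proper R I →
             Σ (Ideal R) λ J → Proper R J × I ⊆ J × Saturated g J
  saturate {zero}  g {I} I-proper = I , I-proper , id , λ ()
  saturate {suc n} g {I} I-proper with dec (1# ∈ᵢ I ⊕ ⟨ g zero ⟩)
  ... | yes 1∈I⊕g₀ with saturate (g ∘ suc) {I} I-proper
  ...   | J , J-proper , I⊆J , J-saturated =
          J , J-proper , I⊆J
        , λ { zero    → inj₂ (⊕-monoˡ {I} {J} {⟨ g zero ⟩} I⊆J 1∈I⊕g₀)
            ; (suc i) → J-saturated i }
  saturate {suc n} g {I} I-proper | no 1∉I⊕g₀ with saturate (g ∘ suc) {I ⊕ ⟨ g zero ⟩} 1∉I⊕g₀
  ...   | J , J-proper , I⊕g₀⊆J , J-saturated =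
          J , J-proper , (λ i∈I → I⊕g₀⊆J (⊕-inˡ {I} {⟨ g zero ⟩} i∈I))
        , λ { zero    → inj₁ (I⊕g₀⊆J (⊕-inʳ {I} {⟨ g zero ⟩} (x∈⟨x⟩ (g zero))))
            ; (suc i) → J-saturated i }

module FiniteLocal {c ℓ} (R : CommutativeRing c ℓ) (finite : IsFinite R) (local : IsLocal R) where

  open CommutativeRing R hiding (zero)

  N : ℕ
  N = proj₁ finite

  enum : Fin N → Carrier
  enum = proj₁ (proj₂ finite)

  enum-onto : ∀ x → ∃ λ i → enum i ≈ x
  enum-onto = proj₂ (proj₂ finite)

  M : Ideal R
  M = proj₁ local

  M-maximal : IsMaximal R M
  M-maximal = proj₁ (proj₂ local)

  M-unique : ∀ J → IsMaximal R J → _≐ᵢ_ R J M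
  M-unique = proj₂ (proj₂ local)

  open Ideals R
  open import Algebra.Properties.Ring ring using ([y-z]x≈yx-zx)
  open import Algebra.Properties.CommutativeSemigroup *-commutativeSemigroup using (xy∙z≈y∙xz)
  open import Relation.Binary.Reasoning.Setoid setoid

  dec : (P : Set (c ⊔ ℓ)) → Dec P
  dec = maximal⇒dec {M} M-maximal

  dec≈ : ∀ x y → Dec (x ≈ y)
  dec≈ x y = map′ lower lift (dec (Lift c (x ≈ y)))

  open Saturation R dec

  saturated⇒maximal : ∀ {J} → Proper R J → Saturated enum J → IsMaximal R J
  saturated⇒maximal {J} J-proper J-saturated = J-proper , maximal
    where
    maximal : ∀ K → J ⊆ K → _≐ᵢ_ R K J ⊎ 1# ∈ᵢ K
    maximal K J⊆K with dec (1# ∈ᵢ K)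
    ... | yes 1∈K = inj₂ 1∈K
    ... | no 1∉K  = inj₁ (K⊆J , J⊆K)
      where
      K⊆J : K ⊆ J
      K⊆J {x} x∈K with enum-onto x
      ... | i , enumᵢ≈x with J-saturated i
      ...   | inj₁ enumᵢ∈J  = resp J enumᵢ≈x enumᵢ∈J
      ...   | inj₂ 1∈J⊕enumᵢ =
              contradiction (⊕-least {J} {⟨ enum i ⟩} {K} J⊆K (⟨⟩-least {K} (resp K (sym enumᵢ≈x) x∈K)) 1∈J⊕enumᵢ) 1∉K

  nonunit∈M : ∀ {x} → ¬ Unit x → x ∈ᵢ M
  nonunit∈M {x} ¬unit with saturate enum {⟨ x ⟩} (¬unit ∘ 1∈⟨x⟩⇒unit)
  ... | J , J-proper , ⟨x⟩⊆J , J-saturated =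
        proj₁ (M-unique J (saturated⇒maximal {J} J-proper J-saturated)) (⟨x⟩⊆J (x∈⟨x⟩ x))

  1-m-unit : ∀ {m} → m ∈ᵢ M → Unit (1# - m)
  1-m-unit {m} m∈M with dec (Unit (1# - m))
  ... | yes unit = unit
  ... | no ¬unit = contradiction (resp M 1-m+m≈1 (+-closed M (nonunit∈M ¬unit) m∈M)) (proj₁ M-maximal)
    where
    1-m+m≈1 : 1# - m + m ≈ 1#
    1-m+m≈1 = trans (+-assoc 1# (- m) m) (trans (+-cong refl (-‿inverseˡ m)) (+-identityʳ 1#))

  absorbed⇒zero : ∀ {m g} → m ∈ᵢ M → m * g ≈ g → g ≈ 0#
  absorbed⇒zero {m} {g} m∈M mg≈g with 1-m-unit m∈M
  ... | w , [1-m]w≈1 = begin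
    g                   ≈⟨ *-identityˡ g ⟨
    1# * g              ≈⟨ *-cong [1-m]w≈1 refl ⟨
    ((1# - m) * w) * g  ≈⟨ xy∙z≈y∙xz (1# - m) w g ⟩
    w * ((1# - m) * g)  ≈⟨ *-cong refl [1-m]g≈0 ⟩
    w * 0#              ≈⟨ zeroʳ w ⟩
    0#                  ∎
    where
    [1-m]g≈0 : (1# - m) * g ≈ 0#
    [1-m]g≈0 = begin
      (1# - m) * g    ≈⟨ [y-z]x≈yx-zx g 1# m ⟩
      1# * g - m * g  ≈⟨ +-cong (*-identityˡ g) (-‿cong mg≈g) ⟩
      g - g           ≈⟨ -‿inverseʳ g ⟩
      0#              ∎

  member? : ∀ I → Decidable (λ i → enum i ∈ᵢ I)
  member? I i = dec (enum i ∈ᵢ I)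

  card : Ideal R → ℕ
  card I = ∣ subsetOf (member? I) ∣

  members-mono : ∀ {I J} → I ⊆ J → subsetOf (member? I) ⊆ˢ subsetOf (member? J)
  members-mono {I} {J} I⊆J i∈I = from (∈-subsetOf (member? J)) (I⊆J (to (∈-subsetOf (member? I)) i∈I))

  card-mono : ∀ {I J} → I ⊆ J → card I ≤ card J
  card-mono {I} {J} I⊆J = p⊆q⇒∣p∣≤∣q∣ (members-mono {I} {J} I⊆J)

  card-< : ∀ {I J x} → I ⊆ J → x ∈ᵢ J → ¬ x ∈ᵢ I → card I < card J
  card-< {I} {J} {x} I⊆J x∈J x∉I with enum-onto x
  ... | i , enumᵢ≈x = p⊂q⇒∣p∣<∣q∣
    ( members-mono {I} {J} I⊆J
    , i , from (∈-subsetOf (member? J)) (resp J (sym enumᵢ≈x) x∈J)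
    , λ i∈I → x∉I (resp I enumᵢ≈x (to (∈-subsetOf (member? I)) i∈I)) )

  card≤N : ∀ I → card I ≤ N
  card≤N I = ∣p∣≤n (subsetOf (member? I))

  card-cong : ∀ {I J} → _≐ᵢ_ R I J → card I ≡ card J
  card-cong {I} {J} (I⊆J , J⊆I) = ≤-antisym (card-mono {I} {J} I⊆J) (card-mono {J} {I} J⊆I)

  Ann-cong : ∀ {a b} → a ≈ b → _≐ᵢ_ R (Ann a) (Ann b)
  Ann-cong a≈b = (λ (lift ax≈0) → lift (trans (*-cong (sym a≈b) refl) ax≈0))
               , (λ (lift bx≈0) → lift (trans (*-cong a≈b refl) bx≈0))

  ⟨⟩-cong : ∀ {a b} → a ≈ b → _≐ᵢ_ R ⟨ a ⟩ ⟨ b ⟩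
  ⟨⟩-cong {a} {b} a≈b = ⟨⟩-least {⟨ b ⟩} (resp ⟨ b ⟩ (sym a≈b) (x∈⟨x⟩ b))
                      , ⟨⟩-least {⟨ a ⟩} (resp ⟨ a ⟩ a≈b (x∈⟨x⟩ a))

  index : Carrier → ℕ
  index x = firstIndex (λ i → dec≈ (enum i) x)

  index-spec : ∀ x → ∃ λ i → toℕ i ≡ index x × enum i ≈ x
  index-spec x = firstIndex-spec (λ i → dec≈ (enum i) x) (proj₂ (enum-onto x))

  index<N : ∀ x → index x < N
  index<N x with index-spec x
  ... | i , i≡ , _ = ≡.subst (_< N) i≡ (toℕ<n i)

  index-cong : ∀ {x y} → x ≈ y → index x ≡ index y
  index-cong {x} {y} x≈y = firstIndex-cong (λ i → dec≈ (enum i) x) (λ i → dec≈ (enum i) y)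
                                           (λ _ e → trans e x≈y) (λ _ e → trans e (sym x≈y))

  index-injective : ∀ {x y} → index x ≡ index y → x ≈ y
  index-injective {x} {y} e with index-spec x | index-spec y
  ... | i , i≡ , enumᵢ≈x | j , j≡ , enumⱼ≈y with toℕ-injective (≡.trans i≡ (≡.trans e (≡.sym j≡)))
  ...   | ≡.refl = trans (sym enumᵢ≈x) enumⱼ≈y

module FiniteLocalPIR {c ℓ} (R : CommutativeRing c ℓ) (finite : IsFinite R) (local : IsLocal R)
                      (pir : IsPrincipalIdealRing R) where

  open CommutativeRing R hiding (zero)
  open Ideals R
  open FiniteLocal R finite local
  open import Relation.Binary.Reasoning.Setoid setoid

  generator-zero : ∀ {a b g r s} → g ∈ᵢ ⟨ a ⟩ ⊕ ⟨ b ⟩ → a ≈ r * g → b ≈ s * g → r ∈ᵢ M → s ∈ᵢ M → g ≈ 0#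
  generator-zero {a} {b} {g} {r} {s} (i , j , (x , i≈xa) , (y , j≈yb) , g≈i+j) a≈rg b≈sg r∈M s∈M =
    absorbed⇒zero (+-closed M (*-closed M x r∈M) (*-closed M y s∈M)) (begin
      (x * r + y * s) * g        ≈⟨ distribʳ g (x * r) (y * s) ⟩
      x * r * g + y * s * g      ≈⟨ +-cong (*-assoc x r g) (*-assoc y s g) ⟩
      x * (r * g) + y * (s * g)  ≈⟨ +-cong (*-cong refl a≈rg) (*-cong refl b≈sg) ⟨
      x * a + y * b              ≈⟨ +-cong i≈xa j≈yb ⟨
      i + j                      ≈⟨ g≈i+j ⟨
      g                          ∎)

  divides-total : ∀ a b → b ∈ᵢ ⟨ a ⟩ ⊎ a ∈ᵢ ⟨ b ⟩
  divides-total a b with pir (⟨ a ⟩ ⊕ ⟨ b ⟩)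
  ... | g , ∈⇔∈⟨g⟩
      with to (∈⇔∈⟨g⟩ a) (⊕-inˡ {⟨ a ⟩} {⟨ b ⟩} (x∈⟨x⟩ a)) | to (∈⇔∈⟨g⟩ b) (⊕-inʳ {⟨ a ⟩} {⟨ b ⟩} (x∈⟨x⟩ b))
  ...   | r , a≈rg | s , b≈sg with dec (Unit r) | dec (Unit s)
  ...     | yes r-unit | _          = inj₁ (⟨⟩-least {⟨ a ⟩} (unit-factor r-unit a≈rg) (s , b≈sg))
  ...     | no _       | yes s-unit = inj₂ (⟨⟩-least {⟨ b ⟩} (unit-factor s-unit b≈sg) (r , a≈rg))
  ...     | no r-nonunit | no s-nonunit = inj₁ (resp ⟨ a ⟩ (sym b≈0) (has0 ⟨ a ⟩))
    where
    g≈0 : g ≈ 0#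
    g≈0 = generator-zero (from (∈⇔∈⟨g⟩ g) (x∈⟨x⟩ g)) a≈rg b≈sg (nonunit∈M r-nonunit) (nonunit∈M s-nonunit)
    b≈0 : b ≈ 0#
    b≈0 = trans b≈sg (trans (*-cong refl g≈0) (zeroʳ s))

  ideals-total : ∀ I J → I ⊆ J ⊎ J ⊆ I
  ideals-total I J with pir I | pir J
  ... | g , I⇔⟨g⟩ | h , J⇔⟨h⟩ with divides-total g h
  ...   | inj₁ h∈⟨g⟩ = inj₂ λ {x} x∈J → from (I⇔⟨g⟩ x) (⟨⟩-least {⟨ g ⟩} h∈⟨g⟩ (to (J⇔⟨h⟩ x) x∈J))
  ...   | inj₂ g∈⟨h⟩ = inj₁ λ {x} x∈I → from (J⇔⟨h⟩ x) (⟨⟩-least {⟨ h ⟩} g∈⟨h⟩ (to (I⇔⟨g⟩ x) x∈I))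

  ∉⇔card< : ∀ {x I} → (¬ x ∈ᵢ I) ⇔ card I < card ⟨ x ⟩
  ∉⇔card< {x} {I} = mk⇔ ∉⇒card< λ card< x∈I → <⇒≱ card< (card-mono {⟨ x ⟩} {I} (⟨⟩-least {I} x∈I))
    where
    ∉⇒card< : ¬ x ∈ᵢ I → card I < card ⟨ x ⟩
    ∉⇒card< x∉I with ideals-total I ⟨ x ⟩
    ... | inj₁ I⊆⟨x⟩ = card-< {I} {⟨ x ⟩} I⊆⟨x⟩ (x∈⟨x⟩ x) x∉I
    ... | inj₂ ⟨x⟩⊆I = contradiction (⟨x⟩⊆I (x∈⟨x⟩ x)) x∉I

  nonzero-product⇔card< : ∀ {a b} → (¬ a * b ≈ 0#) ⇔ card (Ann a) < card ⟨ b ⟩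
  nonzero-product⇔card< {a} {b} = mk⇔ (λ ab≉0 → to (∉⇔card< {b} {Ann a}) (ab≉0 ∘ lower))
                                      (λ card< ab≈0 → from (∉⇔card< {b} {Ann a}) card< (lift ab≈0))

  SquareZero : Carrier → Set ℓ
  SquareZero x = x * x ≈ 0#

  squareZero? : ∀ x → Dec (SquareZero x)
  squareZero? x = dec≈ (x * x) 0#

  SquareZero-resp : ∀ {x y} → x ≈ y → SquareZero x → SquareZero y
  SquareZero-resp x≈y xx≈0 = trans (*-cong (sym x≈y) (sym x≈y)) xx≈0

  square≉0-product : ∀ {a b} → ¬ SquareZero a → ¬ SquareZero b → ¬ a * b ≈ 0#
  square≉0-product {a} {b} aa≉0 bb≉0 ab≈0 with divides-total a b
  ... | inj₁ b∈⟨a⟩ = bb≉0 (lower (⟨⟩-least {Ann b} (lift (trans (*-comm b a) ab≈0)) b∈⟨a⟩))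
  ... | inj₂ a∈⟨b⟩ = aa≉0 (lower (⟨⟩-least {Ann a} (lift ab≈0) a∈⟨b⟩))

  square≈0-product : ∀ {a b} → SquareZero a → SquareZero b → a * b ≈ 0#
  square≈0-product {a} {b} aa≈0 bb≈0 with divides-total a b
  ... | inj₁ b∈⟨a⟩ = lower (⟨⟩-least {Ann a} (lift aa≈0) b∈⟨a⟩)
  ... | inj₂ a∈⟨b⟩ = trans (*-comm a b) (lower (⟨⟩-least {Ann b} (lift bb≈0) a∈⟨b⟩))

  nonzero-product-comm : ∀ {a b} → ¬ a * b ≈ 0# → ¬ b * a ≈ 0#
  nonzero-product-comm {a} {b} ab≉0 ba≈0 = ab≉0 (trans (*-comm a b) ba≈0)

  card-Ann : Carrier → ℕ
  card-Ann x = card (Ann x)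

  card-⟨⟩ : Carrier → ℕ
  card-⟨⟩ x = card ⟨ x ⟩

  card-Ann-cong : ∀ {x y} → x ≈ y → card-Ann x ≡ card-Ann y
  card-Ann-cong {x} {y} x≈y = card-cong {Ann x} {Ann y} (Ann-cong x≈y)

  card-⟨⟩-cong : ∀ {x y} → x ≈ y → card-⟨⟩ x ≡ card-⟨⟩ y
  card-⟨⟩-cong {x} {y} x≈y = card-cong {⟨ x ⟩} {⟨ y ⟩} (⟨⟩-cong x≈y)

  card-⟨⟩≤N : ∀ x → card-⟨⟩ x ≤ N
  card-⟨⟩≤N x = card≤N ⟨ x ⟩

  square≈0-nonadjacent : ∀ {a b} → SquareZero a → SquareZero b → ¬ ¬ a * b ≈ 0#
  square≈0-nonadjacent aa≈0 bb≈0 ab≉0 = ab≉0 (square≈0-product aa≈0 bb≈0)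

  open SplitThresholdGraph _≈_ sym (ComplAdj R) nonzero-product-comm
    N index index<N index-cong index-injective
    squareZero? SquareZero-resp card-Ann card-⟨⟩ card-Ann-cong card-⟨⟩-cong card-⟨⟩≤N
    square≉0-product square≈0-nonadjacent (λ _ _ → nonzero-product⇔card<)
    public

theorem2p1 : {c ℓ : Level} (R : CommutativeRing c ℓ) →
    IsFinite R → IsLocal R → IsPrincipalIdealRing R →
    ComplementZeroDivisorGraphIsDivisorGraph R
theorem2p1 R finite local pir =
  φ , (λ {a} _ → φ-positive a) , (λ _ _ → ≈⇔φ≡) , (λ _ _ → E⇔comparable)
  where open FiniteLocalPIR R finite local pir
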